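{- Let $\mathcal T\in\Sigma^n$ be a text and $\pi$ an order-preserving permutation for $\mathcal T$. For any string $P\in\Sigma^+$ that occurs in $\mathcal T$ there exists exactly one primary occurrence $\mathcal T[i,i+|P|-1]=P$. Furthermore, this occurrence is the one minimizing $\pi(i)$ among all occurrences of $P$.
   Context: A text is a string $\mathcal T\in\Sigma^n$ (1-indexed) whose last symbol $\$$ occurs only at position $n$ and is smaller than all other symbols. $\mathrm{rlce}(i,j)$ is the length of the longest common prefix of $\mathcal T[i,n],\mathcal T[j,n]$. A permutation $\pi$ of $[n]$ is order-preserving for $\mathcal T$ if for all $i,j\in[n-1]$, $\pi(i)<\pi(j)$ and $\mathcal T[i,i+1]=\mathcal T[j,j+1]$ imply $\pi(i+1)<\pi(j+1)$. $\mathrm{LPF}_\pi[i]=0$ if $\pi(i)=1$, else $\max_{j:\pi(j)<\pi(i)}\mathrm{rlce}(j,i)$. An occurrence $\mathcal T[i,i+|P|-1]=P$ is primary if $\mathrm{LPF}_\pi[i]<|P|$, and secondary otherwise. -}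

module Defs where

open import Level using (0ℓ)
open import Data.Nat as ℕ using (ℕ; zero; suc; _⊔_)
open import Data.Fin as Fin using (Fin; inject₁; fromℕ; _<?_)
open import Data.Fin.Permutation using (Permutation′; _⟨$⟩ʳ_)
open import Data.List using (List; []; _∷_; _++_; length; foldr; allFin)
open import Data.Vec as Vec using (Vec; lookup; toList; drop)
open import Data.Product using (∃; _×_)
open import Relation.Binary using (Rel; IsStrictTotalOrder; DecidableEquality)
open import Relation.Binary.PropositionalEquality using (_≡_; _≢_)
open import Relation.Nullary using (yes; no; ¬_)

record Alphabet : Set₁ where
  field
    Sym   : Set
    _≟_   : DecidableEquality Sym
    _≺_   : Rel Sym 0ℓ
    isSTO : IsStrictTotalOrder _≡_ _≺_

module _ (Σ : Alphabet) where
  open Alphabet Σ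

  -- positions are 0-indexed: Fin n, position i here is position i+1 of the paper.

  suffix : ∀ {n} → Vec Sym n → Fin n → List Sym
  suffix (x Vec.∷ xs) Fin.zero    = x ∷ toList xs
  suffix (x Vec.∷ xs) (Fin.suc i) = suffix xs i

  lcp : List Sym → List Sym → ℕ
  lcp []       _        = 0
  lcp (_ ∷ _)  []       = 0
  lcp (x ∷ xs) (y ∷ ys) with x ≟ y
  ... | yes _ = suc (lcp xs ys)
  ... | no  _ = 0

  rlce : ∀ {n} → Vec Sym n → Fin n → Fin n → ℕ
  rlce T i j = lcp (suffix T i) (suffix T j)

  IsText : ∀ {m} → Vec Sym (suc m) → Set
  IsText {m} T = ∀ (i : Fin (suc m)) → i ≢ fromℕ m → lookup T (fromℕ m) ≺ lookup T i

  -- π is order-preserving for T: for all i, j < n-1 (0-indexed positions inject₁ i,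
  -- with successor suc i), π(i) < π(j) and T[i,i+1] = T[j,j+1] imply π(i+1) < π(j+1).
  OrderPreserving : ∀ {m} → Vec Sym (suc m) → Permutation′ (suc m) → Set
  OrderPreserving {m} T π =
    ∀ (i j : Fin m) →
      (π ⟨$⟩ʳ inject₁ i) Fin.< (π ⟨$⟩ʳ inject₁ j) →
      lookup T (inject₁ i) ≡ lookup T (inject₁ j) →
      lookup T (Fin.suc i) ≡ lookup T (Fin.suc j) →
      (π ⟨$⟩ʳ Fin.suc i) Fin.< (π ⟨$⟩ʳ Fin.suc j)

  -- LPF_π[i] = max over j with π(j) < π(i) of rlce(j, i); the max over the empty
  -- set (the case π(i) is the smallest value) is 0.
  LPF : ∀ {n} → Vec Sym n → Permutation′ n → Fin n → ℕ
  LPF {n} T π i =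
    foldr (λ j acc → (rlceIf j) ⊔ acc) 0 (allFin n)
    where
      rlceIf : Fin n → ℕ
      rlceIf j with (π ⟨$⟩ʳ j) <? (π ⟨$⟩ʳ i)
      ... | yes _ = rlce T j i
      ... | no  _ = 0

  OccursAt : ∀ {n} → Vec Sym n → List Sym → Fin n → Set
  OccursAt T P i = ∃ λ rest → suffix T i ≡ P ++ rest

  Occurs : ∀ {n} → Vec Sym n → List Sym → Set
  Occurs T P = ∃ λ i → OccursAt T P i

  Primary : ∀ {n} → Vec Sym n → Permutation′ n → List Sym → Fin n → Set
  Primary T π P i = OccursAt T P i × LPF T π i ℕ.< length P

{-# OPTIONS --safe #-}
module Submission where

-- Let i be an occurrence of P with π(i) minimal. A position j with π(j) < π(i) and
-- rlce(j, i) ≥ |P| would be an occurrence preceding i in π, so LPF_π[i] < |P| and i is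
-- primary. Any other occurrence j has π(i) < π(j) and rlce(i, j) ≥ |P|, so
-- LPF_π[j] ≥ |P| and j is secondary.

open import Level using (Level)
open import Defs
open import Data.Nat using (ℕ; suc; _⊔_; _≤_; _<_; z≤n; s≤s)
open import Data.Nat.Properties
  using (≤-refl; ≤-reflexive; ≤-trans; ≤-pred; m≤m⊔n; m≤n⊔m; ⊔-lub; ≮⇒≥; <⇒≱; ≰⇒>)
  renaming (_≤?_ to _ℕ≤?_; _<?_ to _ℕ<?_)
open import Data.Fin as Fin using (Fin; toℕ)
open import Data.Fin.Properties using (any?; ≤∧≢⇒<)
open import Data.Fin.Permutation using (Permutation′; _⟨$⟩ʳ_)
open import Data.Vec using (Vec)
open import Data.List using (List; []; _∷_; _++_; length; foldr; allFin)
open import Data.List.Membership.Propositional using (_∈_)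
open import Data.List.Membership.Propositional.Properties using (∈-allFin)
open import Data.List.Relation.Unary.Any using (here; there)
open import Data.Product using (∃; _×_; _,_)
open import Data.Empty using (⊥-elim)
open import Function using (_∘_; Injection)
open import Function.Properties.Inverse using (↔⇒↣)
open import Relation.Nullary using (yes; no)
open import Relation.Nullary.Decidable using (_×-dec_)
open import Relation.Unary using (Pred; Decidable)
open import Relation.Binary.PropositionalEquality using (_≡_; _≢_; refl; sym; cong; subst)

private variable
  a ℓ : Level
  A : Set a

module _ (f : A → ℕ) where

  ⊔-over : List A → ℕ
  ⊔-over = foldr (λ x acc → f x ⊔ acc) 0

  ≤-⊔-over : ∀ {x xs} → x ∈ xs → f x ≤ ⊔-over xs
  ≤-⊔-over {xs = y ∷ ys} (here refl)  = m≤m⊔n (f y) (⊔-over ys)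
  ≤-⊔-over {xs = y ∷ ys} (there x∈ys) = ≤-trans (≤-⊔-over x∈ys) (m≤n⊔m (f y) (⊔-over ys))

  ⊔-over-< : ∀ {k} xs → 0 < k → (∀ x → f x < k) → ⊔-over xs < k
  ⊔-over-< []       0<k f<k = 0<k
  ⊔-over-< (x ∷ xs) 0<k f<k = ⊔-lub (f<k x) (⊔-over-< xs 0<k f<k)

⊔-over-summand : ∀ {f : A → ℕ} xs {m} → ⊔-over f xs ≡ m → A → ℕ
⊔-over-summand {f = f} _ _ = f

module _ {n} {P : Pred (Fin n) ℓ} (P? : Decidable P) (f : Fin n → ℕ) where

  ∃-minimal : ∃ P → ∃ λ i → P i × (∀ j → P j → f i ≤ f j)
  ∃-minimal (j , pj) = search (suc (f j)) j ≤-refl pj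
    where
    search : ∀ b j → f j < b → P j → ∃ λ i → P i × (∀ k → P k → f i ≤ f k)
    search (suc b) j fj<b pj with any? (λ k → (f k ℕ<? f j) ×-dec P? k)
    ... | yes (k , fk<fj , pk) = search b k (≤-trans fk<fj (≤-pred fj<b)) pk
    ... | no ∄smaller          = j , pj , λ k pk → ≮⇒≥ (λ fk<fj → ∄smaller (k , fk<fj , pk))

module _ (Σ : Alphabet) where
  open Alphabet Σ

  length≤lcp-++ : ∀ (P r r′ : List Sym) → length P ≤ lcp Σ (P ++ r) (P ++ r′)
  length≤lcp-++ []      r r′ = z≤n
  length≤lcp-++ (p ∷ P) r r′ with p ≟ p
  ... | yes _  = s≤s (length≤lcp-++ P r r′)
  ... | no p≢p = ⊥-elim (p≢p refl)

  length≤lcp⇒prefix : ∀ (P r xs : List Sym) → length P ≤ lcp Σ xs (P ++ r) → ∃ λ r′ → xs ≡ P ++ r′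
  length≤lcp⇒prefix []      r xs       _ = xs , refl
  length≤lcp⇒prefix (p ∷ P) r []       ()
  length≤lcp⇒prefix (p ∷ P) r (x ∷ xs) P≤lcp with x ≟ p
  length≤lcp⇒prefix (p ∷ P) r (x ∷ xs) () | no _
  ... | yes refl with r′ , xs≡P++r′ ← length≤lcp⇒prefix P r xs (≤-pred P≤lcp) = r′ , cong (x ∷_) xs≡P++r′

  module _ {n} (T : Vec Sym n) (π : Permutation′ n) where

    -- The summand of LPF is local to its definition; unification recovers it from LPF itself.
    LPF-summand : Fin n → Fin n → ℕ
    LPF-summand i = ⊔-over-summand (allFin n) (refl {x = LPF Σ T π i})

    LPF-summand-< : ∀ {i j} → (π ⟨$⟩ʳ j) Fin.< (π ⟨$⟩ʳ i) → LPF-summand i j ≡ rlce Σ T j i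
    LPF-summand-< {i} {j} πj<πi with (π ⟨$⟩ʳ j) Fin.<? (π ⟨$⟩ʳ i)
    ... | yes _    = refl
    ... | no πj≮πi = ⊥-elim (πj≮πi πj<πi)

    rlce≤LPF : ∀ {i j} → (π ⟨$⟩ʳ j) Fin.< (π ⟨$⟩ʳ i) → rlce Σ T j i ≤ LPF Σ T π i
    rlce≤LPF {i} {j} πj<πi =
      ≤-trans (≤-reflexive (sym (LPF-summand-< πj<πi))) (≤-⊔-over (LPF-summand i) (∈-allFin j))

    LPF< : ∀ {i k} → 0 < k → (∀ j → (π ⟨$⟩ʳ j) Fin.< (π ⟨$⟩ʳ i) → rlce Σ T j i < k) → LPF Σ T π i < k
    LPF< {i} {k} 0<k rlce<k = ⊔-over-< (LPF-summand i) (allFin n) 0<k summand<k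
      where
      summand<k : ∀ j → LPF-summand i j < k
      summand<k j with (π ⟨$⟩ʳ j) Fin.<? (π ⟨$⟩ʳ i)
      ... | yes πj<πi = rlce<k j πj<πi
      ... | no  _     = 0<k

    module _ {P : List Sym} where

      length≤rlce : ∀ {i j} → OccursAt Σ T P i → OccursAt Σ T P j → length P ≤ rlce Σ T i j
      length≤rlce (r , Tᵢ≡P++r) (r′ , Tⱼ≡P++r′) rewrite Tᵢ≡P++r | Tⱼ≡P++r′ = length≤lcp-++ P r r′

      length≤rlce⇒OccursAt : ∀ {i j} → OccursAt Σ T P i → length P ≤ rlce Σ T j i → OccursAt Σ T P j
      length≤rlce⇒OccursAt {i} {j} (r , Tᵢ≡P++r) P≤rlce =
        length≤lcp⇒prefix P r (suffix Σ T j) (subst (λ s → length P ≤ lcp Σ (suffix Σ T j) s) Tᵢ≡P++r P≤rlce)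

      IsπMinimalOccurrence : Fin n → Set
      IsπMinimalOccurrence i = OccursAt Σ T P i × (∀ j → OccursAt Σ T P j → (π ⟨$⟩ʳ i) Fin.≤ (π ⟨$⟩ʳ j))

      -- Occurring is decided against a known occurrence i₀ through rlce(j, i₀) ≥ |P|.
      ∃-πMinimalOccurrence : Occurs Σ T P → ∃ IsπMinimalOccurrence
      ∃-πMinimalOccurrence (i₀ , occ₀)
        with i , P≤rlceᵢ , minimal ← ∃-minimal (λ j → length P ℕ≤? rlce Σ T j i₀) (toℕ ∘ (π ⟨$⟩ʳ_))
                                               (i₀ , length≤rlce occ₀ occ₀)
        = i , length≤rlce⇒OccursAt occ₀ P≤rlceᵢ , λ j occⱼ → minimal j (length≤rlce occⱼ occ₀)

      πMinimalOccurrence⇒Primary : ∀ {i} → P ≢ [] → IsπMinimalOccurrence i → Primary Σ T π P i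
      πMinimalOccurrence⇒Primary {i} P≢[] (occᵢ , minimal) = occᵢ , LPF< (nonempty P P≢[]) rlce<length
        where
        nonempty : ∀ Q → Q ≢ [] → 0 < length Q
        nonempty []      []≢[] = ⊥-elim ([]≢[] refl)
        nonempty (_ ∷ _) _     = s≤s z≤n
        rlce<length : ∀ j → (π ⟨$⟩ʳ j) Fin.< (π ⟨$⟩ʳ i) → rlce Σ T j i < length P
        rlce<length j πj<πi with length P ℕ≤? rlce Σ T j i
        ... | yes P≤rlce = ⊥-elim (<⇒≱ πj<πi (minimal j (length≤rlce⇒OccursAt occᵢ P≤rlce)))
        ... | no  P≰rlce = ≰⇒> P≰rlce

      π-later-occurrence⇒secondary : ∀ {i j} → OccursAt Σ T P i → OccursAt Σ T P j →
                                     (π ⟨$⟩ʳ i) Fin.< (π ⟨$⟩ʳ j) → length P ≤ LPF Σ T π j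
      π-later-occurrence⇒secondary occᵢ occⱼ πi<πj = ≤-trans (length≤rlce occᵢ occⱼ) (rlce≤LPF πi<πj)

      Primary⇒≡πMinimalOccurrence : ∀ {i j} → IsπMinimalOccurrence i → Primary Σ T π P j → j ≡ i
      Primary⇒≡πMinimalOccurrence {i} {j} (occᵢ , minimal) (occⱼ , LPFⱼ<P) with j Fin.≟ i
      ... | yes j≡i = j≡i
      ... | no  j≢i = ⊥-elim (<⇒≱ LPFⱼ<P (π-later-occurrence⇒secondary occᵢ occⱼ πi<πj))
        where
        πi<πj : (π ⟨$⟩ʳ i) Fin.< (π ⟨$⟩ʳ j)
        πi<πj = ≤∧≢⇒< (minimal j occⱼ) (j≢i ∘ sym ∘ Injection.injective (↔⇒↣ π))

lemma28 : (Σ : Alphabet) (m : ℕ) (T : Vec (Alphabet.Sym Σ) (suc m)) (π : Permutation′ (suc m)) →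
          IsText Σ T → OrderPreserving Σ T π →
          (P : List (Alphabet.Sym Σ)) → P ≢ [] → Occurs Σ T P →
          ∃ λ i → Primary Σ T π P i
                × (∀ j → Primary Σ T π P j → j ≡ i)
                × (∀ j → OccursAt Σ T P j → (π ⟨$⟩ʳ i) Fin.≤ (π ⟨$⟩ʳ j))
lemma28 Σ m T π _ _ P P≢[] occurs
  with i , minimalᵢ@(_ , minimal) ← ∃-πMinimalOccurrence Σ T π occurs
  = i
  , πMinimalOccurrence⇒Primary Σ T π P≢[] minimalᵢ
  , (λ j → Primary⇒≡πMinimalOccurrence Σ T π minimalᵢ)
  , minimal
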